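{- In the setting described in the context, suppose moreover that $T$ is $\Sigma_1$-sound. Then $h(n)=0$ for every $n\in\mathbb{N}$, i.e. $\mathbb{N}\models \forall x\,(h(x)=0)$.
   Context: Theories are in $\mathcal{L}=\{0,\mathsf{S},+,\times\}$ over intuitionistic predicate logic, given by a deductively closed formula set with a $\Sigma_1$ axiom formula; $\mathsf{i}\mathrm{I}\Sigma_1$ is intuitionistic $\Sigma_1$-induction and every theory $T$ satisfies $\vdash_{\mathsf{i}\mathrm{I}\Sigma_1}\mathsf{Bew}_{\mathsf{i}\mathrm{I}\Sigma_1}(x)\to\mathsf{Bew}_T(x)$. A $\Sigma_1$-formula $P(x)$ is a provability predicate for $T$ if, with $\Box A:=P(\ulcorner A\urcorner)$ for sentences: $\vdash_TA\Rightarrow\mathbb{N}\models\Box A$; $\vdash_{\mathsf{i}\mathrm{I}\Sigma_1}\Box(A\to B)\to(\Box A\to\Box B)$; $\vdash_{\mathsf{i}\mathrm{I}\Sigma_1}S\to\Box S$ for $\Sigma_1$-sentences $S$. Setting: $T$ is a theory and $(P,Q)$ a good pair for $T$: with $\Box A:=P(\ulcorner A\urcorner)$, $\triangle A:=Q(\ulcorner A\urcorner)$, $P,Q$ are provability predicates for $T$; $\mathbb{N}\models\Box A$ implies $\vdash_TA$; $\vdash_T(\triangle A\to A)\to A$ for all sentences $A$; $\vdash_T\Box\triangle S\to\Box S$ for all $\Sigma_1$-sentences $S$. IML models $\langle W,\preceq,\sqsubset,V\rangle$: $\preceq$ partial order, $w\preceq v\sqsubset u\Rightarrow w\sqsubset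 u$, $V$ persistent. Irreflexive: $\sqsubset$ irreflexive; realistic: $\sqsubset\subseteq\preceq$. Let $M_0=\langle W_0,\preceq_0,\sqsubset_0,V_0\rangle$ be a finite irreflexive realistic model with $W_0=\{1,\dots,r\}$, $r>0$, $r$ the $\preceq_0$-least element. On $\mathbb{N}$ define $i\preceq j$ iff ($1\le i,j\le r$ and $i\preceq_0j$) or ($i>r$ and $1\le j\le i$) or $i=0$; $i\sqsubset j$ iff ($1\le i,j\le r$ and $i\sqsubset_0j$) or ($i>r$ and $1\le j<i$) or ($i=0$ and $j>0$), formalized by $\Delta_0$-formulas; $x\prec y$ means $x\preceq y\wedge x\ne y$, $x\sqsubseteq y$ means $x\sqsubset y\vee x=y$. Write $P(x)=\exists y\,\mathsf{Prf}_\Box(y,x)$, $Q(x)=\exists y\,\mathsf{Prf}_\triangle(y,x)$ with $\Delta_0$ formulas normalized so that $\vdash_{\mathsf{i}\mathrm{I}\Sigma_1}\mathsf{Prf}(y,x)\to x=p_0(y)$ ($p_0$ first projection of a $\Delta_0$ pairing). The function $h$ ($\Sigma_1$-defined in $\mathsf{i}\mathrm{I}\Sigma_1$ by diagonalization): $h(0)=0$; $h(k+1)=m$ if $h(k)\sqsubset m$ and $\mathsf{Prf}_\Box(k,\ulcorner\exists x\neg(h(x)\sqsubseteq m)\urcorner)$; $h(k+1)=n$ if $h(k)\prec n$ and $\mathsf{Prf}_\triangle(k,\ulcorner\exists y\neg(h(y)\preceq n)\urcorner)$; otherwise $h(k+1)=h(k)$. -}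

module Defs where

open import Data.Nat using (ℕ; zero; suc; _+_; _*_; _≤_; _<_)
open import Data.Fin using (Fin; toℕ) renaming (zero to fz; suc to fs)
open import Data.List using (List; []; _∷_; map)
open import Data.List.Membership.Propositional using (_∈_)
open import Data.List.Relation.Unary.All using (All)
open import Data.Product using (Σ; _×_; _,_)
open import Data.Sum using (_⊎_)
open import Data.Empty using (⊥)
open import Relation.Nullary using (¬_)
open import Relation.Binary.PropositionalEquality using (_≡_)

-- Syntax of first-order arithmetic in L = {0, S, +, ×} (de Bruijn)

infixl 7 _⊗_
infixl 6 _⊕_
infix  4 _≐_
infixr 3 _∧'_
infixr 2 _∨'_
infixr 1 _⇒_

data Term (n : ℕ) : Set where
  var   : Fin n → Term n
  zero' : Term n
  S'    : Term n → Term n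
  _⊕_   : Term n → Term n → Term n
  _⊗_   : Term n → Term n → Term n

data Formula (n : ℕ) : Set where
  ⊥'   : Formula n
  _≐_  : Term n → Term n → Formula n
  _∧'_ : Formula n → Formula n → Formula n
  _∨'_ : Formula n → Formula n → Formula n
  _⇒_  : Formula n → Formula n → Formula n
  ∀'   : Formula (suc n) → Formula n
  ∃'   : Formula (suc n) → Formula n

Sentence : Set
Sentence = Formula 0

¬'_ : ∀ {n} → Formula n → Formula n
¬' A = A ⇒ ⊥'

Ren : ℕ → ℕ → Set
Ren n m = Fin n → Fin m

extR : ∀ {n m} → Ren n m → Ren (suc n) (suc m)
extR ρ fz     = fz
extR ρ (fs i) = fs (ρ i)

renT : ∀ {n m} → Ren n m → Term n → Term m
renT ρ (var i) = var (ρ i)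
renT ρ zero'   = zero'
renT ρ (S' t)  = S' (renT ρ t)
renT ρ (t ⊕ u) = renT ρ t ⊕ renT ρ u
renT ρ (t ⊗ u) = renT ρ t ⊗ renT ρ u

renF : ∀ {n m} → Ren n m → Formula n → Formula m
renF ρ ⊥'       = ⊥'
renF ρ (t ≐ u)  = renT ρ t ≐ renT ρ u
renF ρ (A ∧' B) = renF ρ A ∧' renF ρ B
renF ρ (A ∨' B) = renF ρ A ∨' renF ρ B
renF ρ (A ⇒ B)  = renF ρ A ⇒ renF ρ B
renF ρ (∀' A)   = ∀' (renF (extR ρ) A)
renF ρ (∃' A)   = ∃' (renF (extR ρ) A)

wkT : ∀ {n} → Term n → Term (suc n)
wkT = renT fs

wkF : ∀ {n} → Formula n → Formula (suc n)
wkF = renF fs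

Sub : ℕ → ℕ → Set
Sub n m = Fin n → Term m

extS : ∀ {n m} → Sub n m → Sub (suc n) (suc m)
extS σ fz     = var fz
extS σ (fs i) = wkT (σ i)

subT : ∀ {n m} → Sub n m → Term n → Term m
subT σ (var i) = σ i
subT σ zero'   = zero'
subT σ (S' t)  = S' (subT σ t)
subT σ (t ⊕ u) = subT σ t ⊕ subT σ u
subT σ (t ⊗ u) = subT σ t ⊗ subT σ u

subF : ∀ {n m} → Sub n m → Formula n → Formula m
subF σ ⊥'       = ⊥'
subF σ (t ≐ u)  = subT σ t ≐ subT σ u
subF σ (A ∧' B) = subF σ A ∧' subF σ B
subF σ (A ∨' B) = subF σ A ∨' subF σ B
subF σ (A ⇒ B)  = subF σ A ⇒ subF σ B
subF σ (∀' A)   = ∀' (subF (extS σ) A)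
subF σ (∃' A)   = ∃' (subF (extS σ) A)

sub1 : ∀ {n} → Term n → Sub (suc n) n
sub1 t fz     = t
sub1 t (fs i) = var i

_[_] : ∀ {n} → Formula (suc n) → Term n → Formula n
A [ t ] = subF (sub1 t) A

sub2 : ∀ {n} → Term n → Term n → Sub 2 n
sub2 s t fz      = s
sub2 s t (fs fz) = t
sub2 s t (fs (fs ()))

_⟨_∣_⟩ : ∀ {n} → Formula 2 → Term n → Term n → Formula n
A ⟨ s ∣ t ⟩ = subF (sub2 s t) A

num : ∀ {n} → ℕ → Term n
num zero    = zero'
num (suc k) = S' (num k)

close : ∀ {n} → Formula n → Sentence
close {zero}  A = A
close {suc n} A = close (∀' A)

-- Intuitionistic natural deduction (with equality)

infix 0 _⊢_

data _⊢_ {n : ℕ} (Γ : List (Formula n)) : Formula n → Set where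
  ax   : ∀ {A} → A ∈ Γ → Γ ⊢ A
  ⊥E   : ∀ {A} → Γ ⊢ ⊥' → Γ ⊢ A
  ∧I   : ∀ {A B} → Γ ⊢ A → Γ ⊢ B → Γ ⊢ A ∧' B
  ∧E₁  : ∀ {A B} → Γ ⊢ A ∧' B → Γ ⊢ A
  ∧E₂  : ∀ {A B} → Γ ⊢ A ∧' B → Γ ⊢ B
  ∨I₁  : ∀ {A B} → Γ ⊢ A → Γ ⊢ A ∨' B
  ∨I₂  : ∀ {A B} → Γ ⊢ B → Γ ⊢ A ∨' B
  ∨E   : ∀ {A B C} → Γ ⊢ A ∨' B → (A ∷ Γ) ⊢ C → (B ∷ Γ) ⊢ C → Γ ⊢ C
  ⇒I   : ∀ {A B} → (A ∷ Γ) ⊢ B → Γ ⊢ A ⇒ B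
  ⇒E   : ∀ {A B} → Γ ⊢ A ⇒ B → Γ ⊢ A → Γ ⊢ B
  ∀I   : ∀ {A} → map wkF Γ ⊢ A → Γ ⊢ ∀' A
  ∀E   : ∀ {A} → Γ ⊢ ∀' A → (t : Term n) → Γ ⊢ A [ t ]
  ∃I   : ∀ {A} (t : Term n) → Γ ⊢ A [ t ] → Γ ⊢ ∃' A
  ∃E   : ∀ {A B} → Γ ⊢ ∃' A → (A ∷ map wkF Γ) ⊢ wkF B → Γ ⊢ B
  refl' : ∀ {t} → Γ ⊢ t ≐ t
  ≐E   : ∀ {s t A} → Γ ⊢ s ≐ t → Γ ⊢ A [ s ] → Γ ⊢ A [ t ]

Derivable : (Sentence → Set) → Sentence → Set
Derivable Ax A = Σ (List Sentence) λ Γ → All Ax Γ × (Γ ⊢ A)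

lt : ∀ {n} → Term n → Term n → Formula n
lt s t = ∃' (S' (wkT s) ⊕ var fz ≐ wkT t)

data IsΔ0 {n : ℕ} : Formula n → Set where
  δ⊥   : IsΔ0 ⊥'
  δ≐   : ∀ {s t} → IsΔ0 (s ≐ t)
  δ∧   : ∀ {A B} → IsΔ0 A → IsΔ0 B → IsΔ0 (A ∧' B)
  δ∨   : ∀ {A B} → IsΔ0 A → IsΔ0 B → IsΔ0 (A ∨' B)
  δ⇒   : ∀ {A B} → IsΔ0 A → IsΔ0 B → IsΔ0 (A ⇒ B)
  δ∀<  : ∀ {A} (t : Term n) → IsΔ0 A → IsΔ0 (∀' (lt (var fz) (wkT t) ⇒ A))
  δ∃<  : ∀ {A} (t : Term n) → IsΔ0 A → IsΔ0 (∃' (lt (var fz) (wkT t) ∧' A))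

data IsΣ1 {n : ℕ} : Formula n → Set where
  σΔ0 : ∀ {A} → IsΔ0 A → IsΣ1 A
  σ∃  : ∀ {A} → IsΣ1 A → IsΣ1 (∃' A)

-- induction formula for φ(x, params), x = variable 0
indF : ∀ {n} → Formula (suc n) → Formula n
indF φ = (φ [ zero' ] ∧' ∀' (φ ⇒ subF step φ)) ⇒ ∀' φ
  where
  step : Sub (suc _) (suc _)
  step fz     = S' (var fz)
  step (fs i) = var (fs i)

x₀ x₁ : Term 2
x₀ = var fz
x₁ = var (fs fz)

data IΣ1Ax : Sentence → Set where
  Q1  : IΣ1Ax (∀' (¬' (S' (var fz) ≐ zero')))
  Q2  : IΣ1Ax (∀' (∀' (S' x₀ ≐ S' x₁ ⇒ x₀ ≐ x₁)))
  Q3  : IΣ1Ax (∀' (var fz ⊕ zero' ≐ var fz))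
  Q4  : IΣ1Ax (∀' (∀' (x₀ ⊕ S' x₁ ≐ S' (x₀ ⊕ x₁))))
  Q5  : IΣ1Ax (∀' (var fz ⊗ zero' ≐ zero'))
  Q6  : IΣ1Ax (∀' (∀' (x₀ ⊗ S' x₁ ≐ (x₀ ⊗ x₁) ⊕ x₀)))
  Ind : ∀ {n} (φ : Formula (suc n)) → IsΣ1 φ → IΣ1Ax (close (indF φ))

⊢iIΣ1 : Sentence → Set
⊢iIΣ1 = Derivable IΣ1Ax

⟦_⟧t : ∀ {n} → Term n → (Fin n → ℕ) → ℕ
⟦ var i ⟧t ρ = ρ i
⟦ zero' ⟧t ρ = 0
⟦ S' t  ⟧t ρ = suc (⟦ t ⟧t ρ)
⟦ t ⊕ u ⟧t ρ = ⟦ t ⟧t ρ + ⟦ u ⟧t ρ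
⟦ t ⊗ u ⟧t ρ = ⟦ t ⟧t ρ * ⟦ u ⟧t ρ

cons : ∀ {n} → ℕ → (Fin n → ℕ) → Fin (suc n) → ℕ
cons k ρ fz     = k
cons k ρ (fs i) = ρ i

⟦_⟧ : ∀ {n} → Formula n → (Fin n → ℕ) → Set
⟦ ⊥'     ⟧ ρ = ⊥
⟦ t ≐ u  ⟧ ρ = ⟦ t ⟧t ρ ≡ ⟦ u ⟧t ρ
⟦ A ∧' B ⟧ ρ = ⟦ A ⟧ ρ × ⟦ B ⟧ ρ
⟦ A ∨' B ⟧ ρ = ⟦ A ⟧ ρ ⊎ ⟦ B ⟧ ρ
⟦ A ⇒ B  ⟧ ρ = ⟦ A ⟧ ρ → ⟦ B ⟧ ρ
⟦ ∀' A   ⟧ ρ = (k : ℕ) → ⟦ A ⟧ (cons k ρ)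
⟦ ∃' A   ⟧ ρ = Σ ℕ λ k → ⟦ A ⟧ (cons k ρ)

noEnv : Fin 0 → ℕ
noEnv ()

ℕ⊨_ : Sentence → Set
ℕ⊨ A = ⟦ A ⟧ noEnv

tri : ℕ → ℕ
tri zero    = zero
tri (suc k) = suc k + tri k

pair : ℕ → ℕ → ℕ
pair a b = tri (a + b) + b

codeT : ∀ {n} → Term n → ℕ
codeT (var i) = pair 0 (toℕ i)
codeT zero'   = pair 1 0
codeT (S' t)  = pair 2 (codeT t)
codeT (t ⊕ u) = pair 3 (pair (codeT t) (codeT u))
codeT (t ⊗ u) = pair 4 (pair (codeT t) (codeT u))

⌜_⌝ : ∀ {n} → Formula n → ℕ
⌜ ⊥'     ⌝ = pair 0 0
⌜ t ≐ u  ⌝ = pair 1 (pair (codeT t) (codeT u))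
⌜ A ∧' B ⌝ = pair 2 (pair ⌜ A ⌝ ⌜ B ⌝)
⌜ A ∨' B ⌝ = pair 3 (pair ⌜ A ⌝ ⌜ B ⌝)
⌜ A ⇒ B  ⌝ = pair 4 (pair ⌜ A ⌝ ⌜ B ⌝)
⌜ ∀' A   ⌝ = pair 5 ⌜ A ⌝
⌜ ∃' A   ⌝ = pair 6 ⌜ A ⌝

-- Theories: a Σ1 axiom formula τ(x); T is the deductive closure over
-- iIΣ1 of the sentences A with ℕ ⊨ τ(⌜A⌝).

record Theory : Set₁ where
  field
    Ax      : Sentence → Set
    τ       : Formula 1
    τ-Σ1    : IsΣ1 τ
    τ-axiom : ∀ A → (Ax A → ℕ⊨ (τ [ num ⌜ A ⌝ ])) × (ℕ⊨ (τ [ num ⌜ A ⌝ ]) → Ax A)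

_⊢_ᵀ : Theory → Sentence → Set
T ⊢ A ᵀ = Derivable (λ B → IΣ1Ax B ⊎ Theory.Ax T B) A

Σ1-Sound : Theory → Set
Σ1-Sound T = ∀ (S : Sentence) → IsΣ1 S → T ⊢ S ᵀ → ℕ⊨ S

at : Formula 1 → Sentence → Sentence
at P A = P [ num ⌜ A ⌝ ]

record IsProvabilityPredicate (T : Theory) (P : Formula 1) : Set where
  field
    isΣ1  : IsΣ1 P
    D1    : ∀ A → T ⊢ A ᵀ → ℕ⊨ at P A
    D2    : ∀ A B → ⊢iIΣ1 (at P (A ⇒ B) ⇒ (at P A ⇒ at P B))
    Σ1Com : ∀ S → IsΣ1 S → ⊢iIΣ1 (S ⇒ at P S)

-- (P,Q) good pair for T, with P = ∃y Prf□(y,x), Q = ∃y Prf△(y,x)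
-- (in Prf(y,x): y is variable 0, x is variable 1)
record GoodPair (T : Theory) (Prf□ Prf△ : Formula 2) : Set where
  field
    Prf□-Δ0 : IsΔ0 Prf□
    Prf△-Δ0 : IsΔ0 Prf△
    P-prov  : IsProvabilityPredicate T (∃' Prf□)
    Q-prov  : IsProvabilityPredicate T (∃' Prf△)
    □-sound : ∀ A → ℕ⊨ at (∃' Prf□) A → T ⊢ A ᵀ
    △-refl  : ∀ A → T ⊢ ((at (∃' Prf△) A ⇒ A) ⇒ A) ᵀ
    □△      : ∀ S → IsΣ1 S → T ⊢ (at (∃' Prf□) (at (∃' Prf△) S) ⇒ at (∃' Prf□) S) ᵀ

-- Finite irreflexive realistic IML models with W0 = {1,…,r}

InW : ℕ → ℕ → Set
InW r w = 1 ≤ w × w ≤ r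

record FiniteIRModel : Set₁ where
  field
    r      : ℕ
    r>0    : 0 < r
    _≼₀_   : ℕ → ℕ → Set
    _⊏₀_   : ℕ → ℕ → Set
    V      : ℕ → ℕ → Set     -- V w p : world w forces atom p
    ≼-refl   : ∀ {w} → InW r w → w ≼₀ w
    ≼-trans  : ∀ {u v w} → InW r u → InW r v → InW r w → u ≼₀ v → v ≼₀ w → u ≼₀ w
    ≼-antisym : ∀ {u v} → InW r u → InW r v → u ≼₀ v → v ≼₀ u → u ≡ v
    ≼⊏     : ∀ {u v w} → InW r u → InW r v → InW r w → u ≼₀ v → v ⊏₀ w → u ⊏₀ w
    V-pers : ∀ {u v p} → InW r u → InW r v → u ≼₀ v → V u p → V v p
    irrefl : ∀ {w} → InW r w → ¬ (w ⊏₀ w)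
    realistic : ∀ {u v} → InW r u → InW r v → u ⊏₀ v → u ≼₀ v
    r-least : ∀ {w} → InW r w → r ≼₀ w

module Ordering (M : FiniteIRModel) where
  open FiniteIRModel M

  _≼_ : ℕ → ℕ → Set
  i ≼ j = (InW r i × InW r j × i ≼₀ j) ⊎ (r < i × 1 ≤ j × j ≤ i) ⊎ i ≡ 0

  _⊏_ : ℕ → ℕ → Set
  i ⊏ j = (InW r i × InW r j × i ⊏₀ j) ⊎ (r < i × 1 ≤ j × j < i) ⊎ (i ≡ 0 × 0 < j)

  _≺_ : ℕ → ℕ → Set
  i ≺ j = i ≼ j × ¬ (i ≡ j)

  -- Δ0 formulas (variable 0 = i, variable 1 = j) formalizing ≼ and ⊏
  record Formalization : Set where
    field
      Le Sq  : Formula 2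
      Le-Δ0  : IsΔ0 Le
      Sq-Δ0  : IsΔ0 Sq
      Le-ok  : ∀ i j → (ℕ⊨ (Le ⟨ num i ∣ num j ⟩) → i ≼ j) × (i ≼ j → ℕ⊨ (Le ⟨ num i ∣ num j ⟩))
      Sq-ok  : ∀ i j → (ℕ⊨ (Sq ⟨ num i ∣ num j ⟩) → i ⊏ j) × (i ⊏ j → ℕ⊨ (Sq ⟨ num i ∣ num j ⟩))

  module Codes (F : Formalization) (H : Formula 2) where
    open Formalization F
    -- H(x,y) is the Σ1 graph of h (variable 0 = x, variable 1 = y).
    -- Inside "∃x ¬ ∃y (H(x,y) ∧ …)": y = variable 0, x = variable 1.
    hx=y : Formula 2
    hx=y = H ⟨ var (fs fz) ∣ var fz ⟩

    -- ⌜∃x ¬(h(x) ⊑ m)⌝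
    code⊑ : ℕ → ℕ
    code⊑ m = ⌜ ∃' (¬' (∃' (hx=y ∧' (Sq ⟨ var fz ∣ num m ⟩ ∨' var fz ≐ num m)))) ⌝

    -- ⌜∃y ¬(h(y) ≼ n)⌝
    code≼ : ℕ → ℕ
    code≼ n = ⌜ ∃' (¬' (∃' (hx=y ∧' Le ⟨ var fz ∣ num n ⟩))) ⌝

    Holds : Formula 2 → ℕ → ℕ → Set
    Holds Prf k c = ℕ⊨ (Prf ⟨ num k ∣ num c ⟩)

    BoxMove : (Prf□ : Formula 2) (h : ℕ → ℕ) (k m : ℕ) → Set
    BoxMove Prf□ h k m = h k ⊏ m × Holds Prf□ k (code⊑ m)

    TriMove : (Prf△ : Formula 2) (h : ℕ → ℕ) (k n : ℕ) → Set
    TriMove Prf△ h k n = h k ≺ n × Holds Prf△ k (code≼ n)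

    Step : (Prf□ Prf△ : Formula 2) (h : ℕ → ℕ) (k : ℕ) → Set
    Step Prf□ Prf△ h k =
        (Σ ℕ λ m → BoxMove Prf□ h k m × h (suc k) ≡ m)
      ⊎ ((¬ Σ ℕ (BoxMove Prf□ h k)) × (Σ ℕ λ n → TriMove Prf△ h k n × h (suc k) ≡ n))
      ⊎ ((¬ Σ ℕ (BoxMove Prf□ h k)) × (¬ Σ ℕ (TriMove Prf△ h k)) × h (suc k) ≡ h k)

    Graph : (h : ℕ → ℕ) → Set
    Graph h = ∀ x y → (ℕ⊨ (H ⟨ num x ∣ num y ⟩) → h x ≡ y) × (h x ≡ y → ℕ⊨ (H ⟨ num x ∣ num y ⟩))

    Total : Set
    Total = ⊢iIΣ1 (∀' (∃' (H ⟨ var (fs fz) ∣ var fz ⟩)))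

    Steps : (Prf□ Prf△ : Formula 2) (h : ℕ → ℕ) → Set
    Steps Prf□ Prf△ h = ∀ k → Step Prf□ Prf△ h k

    DefinesH : (Prf□ Prf△ : Formula 2) (h : ℕ → ℕ) → Set
    DefinesH Prf□ Prf△ h = IsΣ1 H × Total × Graph h × h 0 ≡ 0 × Steps Prf□ Prf△ h

-- h is ≼-monotone: each step is a □-move along ⊏ ⊆ ≼, a △-move along ≺, or no move.  The
-- converse of ≺ is well-founded (above r a ≺-step descends in ℕ, and on W₀ it is a partial order
-- on a finite set), so if h ever left 0 it would make a last change at some step j and then stay at
-- v = h(j+1) forever.  Such a last change is impossible.  For a □-move, Prf□(j, ⌜∃x ¬(h(x) ⊑ v)⌝)
-- holds, so T proves ∃x ¬(h(x) ⊑ v) and, by the totality of h, the Σ1 sentence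
-- ∃x ∃y (H(x,y) ∧ ¬(y ⊑ v)); by Σ1-soundness it is true, yet every value of h is ⊑ v.  For a
-- △-move, D1 and D2 for △ give △S for the analogous Σ1 sentence S; as △S is a true Σ1 sentence,
-- T ⊢ □△S, hence T ⊢ □S, and Σ1-soundness twice yields S, although every value of h is ≼ v.
-- The argument runs under a double negation, discharged because equality on ℕ is decidable.

module Submission where

open import Defs
open import Data.Empty using (⊥; ⊥-elim)
open import Data.Fin using (Fin; toℕ; fromℕ<) renaming (zero to fz; suc to fs)
open import Data.Fin.Induction using (po-noetherian)
open import Data.Fin.Properties using (toℕ-injective; toℕ<n; toℕ-fromℕ<)
open import Data.List using (List; []; _∷_; map; _++_)
open import Data.List.Membership.Propositional using (_∈_)
open import Data.List.Membership.Propositional.Properties using (∈-map⁺)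
open import Data.List.Relation.Binary.Subset.Propositional using (_⊆_)
import Data.List.Relation.Binary.Subset.Propositional.Properties as ⊆
open import Data.List.Relation.Unary.All as All using (All; [])
import Data.List.Relation.Unary.All.Properties as Allₚ
open import Data.List.Relation.Unary.Any using (here; there)
open import Data.Nat
  using (ℕ; zero; suc; _+_; _*_; _≤_; _<_; _≤′_; ≤′-refl; ≤′-step; z≤n; s≤s; _≤?_; _≟_)
open import Data.Nat.Induction using (<-wellFounded)
open import Data.Nat.Properties
open import Data.Product using (Σ; _×_; _,_; proj₁; proj₂)
open import Data.Product.Function.Dependent.Propositional using (Σ-⇔)
open import Data.Product.Function.NonDependent.Propositional using (_×-⇔_)
open import Data.Sum using (_⊎_; inj₁; inj₂)
open import Data.Sum.Function.Propositional using (_⊎-⇔_)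
open import Function using (_∘_; flip; case_of_; _⇔_; mk⇔; Equivalence)
open import Function.Construct.Identity using (⇔-id; ↠-id)
open import Function.Related.TypeIsomorphisms using (→-cong-⇔)
open import Induction.WellFounded using (WellFounded; Acc; acc)
open import Level using (0ℓ)
open import Relation.Binary using (Rel; Reflexive; Transitive; DecidableEquality; IsPartialOrder)
import Relation.Binary.Construct.NonStrictToStrict as NonStrictToStrict
open import Relation.Binary.PropositionalEquality
  using (_≡_; _≢_; refl; sym; trans; cong; cong₂; subst; subst₂; isEquivalence)
open import Relation.Nullary using (¬_; yes; no)
open import Relation.Nullary.Decidable using (decidable-stable; ¬¬-excluded-middle)
open Equivalence using (to; from)

wk-subT : ∀ {n m} (t : Term n) (σ : Sub n m) → subT (extS σ) (wkT t) ≡ wkT (subT σ t)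
wk-subT (var i) σ = refl
wk-subT zero'   σ = refl
wk-subT (S' t)  σ = cong S' (wk-subT t σ)
wk-subT (t ⊕ u) σ = cong₂ _⊕_ (wk-subT t σ) (wk-subT u σ)
wk-subT (t ⊗ u) σ = cong₂ _⊗_ (wk-subT t σ) (wk-subT u σ)

wk-wk-subT : ∀ {n m} (t : Term n) (σ : Sub n m) →
             subT (extS (extS σ)) (wkT (wkT t)) ≡ wkT (wkT (subT σ t))
wk-wk-subT t σ = trans (wk-subT (wkT t) (extS σ)) (cong wkT (wk-subT t σ))

renT-as-subT : ∀ {n m} {ρ : Ren n m} {σ : Sub n m} → (∀ i → var (ρ i) ≡ σ i) →
               ∀ t → renT ρ t ≡ subT σ t
renT-as-subT eq (var i) = eq i
renT-as-subT eq zero'   = refl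
renT-as-subT eq (S' t)  = cong S' (renT-as-subT eq t)
renT-as-subT eq (t ⊕ u) = cong₂ _⊕_ (renT-as-subT eq t) (renT-as-subT eq u)
renT-as-subT eq (t ⊗ u) = cong₂ _⊗_ (renT-as-subT eq t) (renT-as-subT eq u)

subT-subT : ∀ {n m k} {σ : Sub m k} {τ : Sub n m} {υ : Sub n k} → (∀ i → subT σ (τ i) ≡ υ i) →
            ∀ t → subT σ (subT τ t) ≡ subT υ t
subT-subT eq (var i) = eq i
subT-subT eq zero'   = refl
subT-subT eq (S' t)  = cong S' (subT-subT eq t)
subT-subT eq (t ⊕ u) = cong₂ _⊕_ (subT-subT eq t) (subT-subT eq u)
subT-subT eq (t ⊗ u) = cong₂ _⊗_ (subT-subT eq t) (subT-subT eq u)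

subT-id : ∀ {n} {σ : Sub n n} → (∀ i → σ i ≡ var i) → ∀ t → subT σ t ≡ t
subT-id eq (var i) = eq i
subT-id eq zero'   = refl
subT-id eq (S' t)  = cong S' (subT-id eq t)
subT-id eq (t ⊕ u) = cong₂ _⊕_ (subT-id eq t) (subT-id eq u)
subT-id eq (t ⊗ u) = cong₂ _⊗_ (subT-id eq t) (subT-id eq u)

extR-as-extS : ∀ {n m} {ρ : Ren n m} {σ : Sub n m} → (∀ i → var (ρ i) ≡ σ i) →
               ∀ i → var (extR ρ i) ≡ extS σ i
extR-as-extS eq fz     = refl
extR-as-extS eq (fs i) = cong wkT (eq i)

extS-subT : ∀ {n m k} {σ : Sub m k} {τ : Sub n m} {υ : Sub n k} → (∀ i → subT σ (τ i) ≡ υ i) →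
            ∀ i → subT (extS σ) (extS τ i) ≡ extS υ i
extS-subT eq fz     = refl
extS-subT {σ = σ} {τ} eq (fs i) = trans (wk-subT (τ i) σ) (cong wkT (eq i))

extS-id : ∀ {n} {σ : Sub n n} → (∀ i → σ i ≡ var i) → ∀ i → extS σ i ≡ var i
extS-id eq fz     = refl
extS-id eq (fs i) = cong wkT (eq i)

renF-as-subF : ∀ {n m} {ρ : Ren n m} {σ : Sub n m} → (∀ i → var (ρ i) ≡ σ i) →
               ∀ A → renF ρ A ≡ subF σ A
renF-as-subF eq ⊥'       = refl
renF-as-subF eq (t ≐ u)  = cong₂ _≐_ (renT-as-subT eq t) (renT-as-subT eq u)
renF-as-subF eq (A ∧' B) = cong₂ _∧'_ (renF-as-subF eq A) (renF-as-subF eq B)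
renF-as-subF eq (A ∨' B) = cong₂ _∨'_ (renF-as-subF eq A) (renF-as-subF eq B)
renF-as-subF eq (A ⇒ B)  = cong₂ _⇒_ (renF-as-subF eq A) (renF-as-subF eq B)
renF-as-subF eq (∀' A)   = cong ∀' (renF-as-subF (extR-as-extS eq) A)
renF-as-subF eq (∃' A)   = cong ∃' (renF-as-subF (extR-as-extS eq) A)

subF-subF : ∀ {n m k} {σ : Sub m k} {τ : Sub n m} {υ : Sub n k} → (∀ i → subT σ (τ i) ≡ υ i) →
            ∀ A → subF σ (subF τ A) ≡ subF υ A
subF-subF eq ⊥'       = refl
subF-subF eq (t ≐ u)  = cong₂ _≐_ (subT-subT eq t) (subT-subT eq u)
subF-subF eq (A ∧' B) = cong₂ _∧'_ (subF-subF eq A) (subF-subF eq B)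
subF-subF eq (A ∨' B) = cong₂ _∨'_ (subF-subF eq A) (subF-subF eq B)
subF-subF eq (A ⇒ B)  = cong₂ _⇒_ (subF-subF eq A) (subF-subF eq B)
subF-subF eq (∀' A)   = cong ∀' (subF-subF (extS-subT eq) A)
subF-subF eq (∃' A)   = cong ∃' (subF-subF (extS-subT eq) A)

subF-id : ∀ {n} {σ : Sub n n} → (∀ i → σ i ≡ var i) → ∀ A → subF σ A ≡ A
subF-id eq ⊥'       = refl
subF-id eq (t ≐ u)  = cong₂ _≐_ (subT-id eq t) (subT-id eq u)
subF-id eq (A ∧' B) = cong₂ _∧'_ (subF-id eq A) (subF-id eq B)
subF-id eq (A ∨' B) = cong₂ _∨'_ (subF-id eq A) (subF-id eq B)
subF-id eq (A ⇒ B)  = cong₂ _⇒_ (subF-id eq A) (subF-id eq B)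
subF-id eq (∀' A)   = cong ∀' (subF-id (extS-id eq) A)
subF-id eq (∃' A)   = cong ∃' (subF-id (extS-id eq) A)

wkF-as-subF : ∀ {n} (A : Formula n) → wkF A ≡ subF (var ∘ fs) A
wkF-as-subF = renF-as-subF (λ _ → refl)

[var₀]-wk₁ : ∀ {n} (A : Formula (suc n)) → renF (extR fs) A [ var fz ] ≡ A
[var₀]-wk₁ A = trans (cong (subF (sub1 (var fz))) (renF-as-subF (λ _ → refl) A))
                     (trans (subF-subF back A) (subF-id (λ _ → refl) A))
  where
  back : ∀ i → subT (sub1 (var fz)) (var (extR fs i)) ≡ var i
  back fz     = refl
  back (fs i) = refl

subΔ0 : ∀ {n m} (σ : Sub n m) {A : Formula n} → IsΔ0 A → IsΔ0 (subF σ A)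
subΔ0 σ δ⊥       = δ⊥
subΔ0 σ δ≐       = δ≐
subΔ0 σ (δ∧ a b) = δ∧ (subΔ0 σ a) (subΔ0 σ b)
subΔ0 σ (δ∨ a b) = δ∨ (subΔ0 σ a) (subΔ0 σ b)
subΔ0 σ (δ⇒ a b) = δ⇒ (subΔ0 σ a) (subΔ0 σ b)
subΔ0 σ (δ∀< {A} t a) =
  subst (λ u → IsΔ0 (∀' (∃' (S' (var (fs fz)) ⊕ var fz ≐ u) ⇒ subF (extS σ) A)))
        (sym (wk-wk-subT t σ)) (δ∀< (subT σ t) (subΔ0 (extS σ) a))
subΔ0 σ (δ∃< {A} t a) =
  subst (λ u → IsΔ0 (∃' (∃' (S' (var (fs fz)) ⊕ var fz ≐ u) ∧' subF (extS σ) A)))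
        (sym (wk-wk-subT t σ)) (δ∃< (subT σ t) (subΔ0 (extS σ) a))

subΣ1 : ∀ {n m} (σ : Sub n m) {A : Formula n} → IsΣ1 A → IsΣ1 (subF σ A)
subΣ1 σ (σΔ0 a) = σΔ0 (subΔ0 σ a)
subΣ1 σ (σ∃ a)  = σ∃ (subΣ1 (extS σ) a)

wkΔ0 : ∀ {n} {A : Formula n} → IsΔ0 A → IsΔ0 (wkF A)
wkΔ0 {A = A} a = subst IsΔ0 (sym (wkF-as-subF A)) (subΔ0 (var ∘ fs) a)

-- Truth in ℕ and soundness of iIΣ1

num-sem : ∀ {n} k (e : Fin n → ℕ) → ⟦ num k ⟧t e ≡ k
num-sem zero    e = refl
num-sem (suc k) e = cong suc (num-sem k e)

module _ {n m} {σ : Sub n m} {e : Fin m → ℕ} {e' : Fin n → ℕ} (eq : ∀ i → ⟦ σ i ⟧t e ≡ e' i) where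

  subT-sem : ∀ t → ⟦ subT σ t ⟧t e ≡ ⟦ t ⟧t e'
  subT-sem (var i) = eq i
  subT-sem zero'   = refl
  subT-sem (S' t)  = cong suc (subT-sem t)
  subT-sem (t ⊕ u) = cong₂ _+_ (subT-sem t) (subT-sem u)
  subT-sem (t ⊗ u) = cong₂ _*_ (subT-sem t) (subT-sem u)

wkT-sem : ∀ {n} (t : Term n) k (e : Fin n → ℕ) → ⟦ wkT t ⟧t (cons k e) ≡ ⟦ t ⟧t e
wkT-sem t k e = trans (cong (λ u → ⟦ u ⟧t (cons k e)) (renT-as-subT (λ _ → refl) t))
                      (subT-sem (λ _ → refl) t)

extS-sem : ∀ {n m} {σ : Sub n m} {e : Fin m → ℕ} {e' : Fin n → ℕ} → (∀ i → ⟦ σ i ⟧t e ≡ e' i) →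
           ∀ k i → ⟦ extS σ i ⟧t (cons k e) ≡ cons k e' i
extS-sem eq k fz     = refl
extS-sem {σ = σ} {e} eq k (fs i) = trans (wkT-sem (σ i) k e) (eq i)

Π-⇔ : {A B : ℕ → Set} → (∀ k → A k ⇔ B k) → ((k : ℕ) → A k) ⇔ ((k : ℕ) → B k)
Π-⇔ A⇔B = mk⇔ (λ f k → to (A⇔B k) (f k)) (λ f k → from (A⇔B k) (f k))

subF-sem : ∀ {n m} {σ : Sub n m} {e : Fin m → ℕ} {e' : Fin n → ℕ} → (∀ i → ⟦ σ i ⟧t e ≡ e' i) →
           ∀ A → ⟦ subF σ A ⟧ e ⇔ ⟦ A ⟧ e'
subF-sem eq ⊥'       = ⇔-id ⊥
subF-sem eq (t ≐ u)  = mk⇔ (subst₂ _≡_ (subT-sem eq t) (subT-sem eq u))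
                           (subst₂ _≡_ (sym (subT-sem eq t)) (sym (subT-sem eq u)))
subF-sem eq (A ∧' B) = subF-sem eq A ×-⇔ subF-sem eq B
subF-sem eq (A ∨' B) = subF-sem eq A ⊎-⇔ subF-sem eq B
subF-sem eq (A ⇒ B)  = →-cong-⇔ (subF-sem eq A) (subF-sem eq B)
subF-sem eq (∀' A)   = Π-⇔ λ k → subF-sem (extS-sem eq k) A
subF-sem eq (∃' A)   = Σ-⇔ (↠-id ℕ) λ {k} → subF-sem (extS-sem eq k) A

wkF-sem : ∀ {n} (A : Formula n) k (e : Fin n → ℕ) → ⟦ wkF A ⟧ (cons k e) ⇔ ⟦ A ⟧ e
wkF-sem A k e = subst (λ B → ⟦ B ⟧ (cons k e) ⇔ ⟦ A ⟧ e) (sym (wkF-as-subF A))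
                      (subF-sem (λ _ → refl) A)

[]-sem : ∀ {n} {t : Term n} {e : Fin n → ℕ} {a} → ⟦ t ⟧t e ≡ a →
         ∀ A → ⟦ A [ t ] ⟧ e ⇔ ⟦ A ⟧ (cons a e)
[]-sem p = subF-sem λ { fz → p ; (fs i) → refl }

env₂ : ℕ → ℕ → Fin 2 → ℕ
env₂ a b = cons a (cons b noEnv)

⟨∣⟩-sem : ∀ {n} {s t : Term n} {e : Fin n → ℕ} {a b} → ⟦ s ⟧t e ≡ a → ⟦ t ⟧t e ≡ b →
          ∀ R → ⟦ R ⟨ s ∣ t ⟩ ⟧ e ⇔ ⟦ R ⟧ (env₂ a b)
⟨∣⟩-sem p q = subF-sem λ { fz → p ; (fs fz) → q }

num⟨∣⟩-sem : ∀ R a b → (ℕ⊨ (R ⟨ num a ∣ num b ⟩)) ⇔ ⟦ R ⟧ (env₂ a b)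
num⟨∣⟩-sem R a b = ⟨∣⟩-sem (num-sem a noEnv) (num-sem b noEnv) R

⟨var₀∣num⟩-intro : ∀ R {y x m} → ℕ⊨ (R ⟨ num y ∣ num m ⟩) → ⟦ R ⟨ var fz ∣ num m ⟩ ⟧ (env₂ y x)
⟨var₀∣num⟩-intro R {y} {x} {m} = from (⟨∣⟩-sem refl (num-sem m (env₂ y x)) R) ∘ to (num⟨∣⟩-sem R y m)

map-wkF-true : ∀ {n} {Γ : List (Formula n)} {e} k →
               All (λ B → ⟦ B ⟧ e) Γ → All (λ B → ⟦ B ⟧ (cons k e)) (map wkF Γ)
map-wkF-true k = Allₚ.map⁺ ∘ All.map λ {B} → from (wkF-sem B k _)

soundness : ∀ {n} {Γ : List (Formula n)} {A} → Γ ⊢ A →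
            ∀ e → All (λ B → ⟦ B ⟧ e) Γ → ⟦ A ⟧ e
soundness (ax A∈Γ)   e Γ-true = All.lookup Γ-true A∈Γ
soundness (⊥E d)     e Γ-true = ⊥-elim (soundness d e Γ-true)
soundness (∧I d d')  e Γ-true = soundness d e Γ-true , soundness d' e Γ-true
soundness (∧E₁ d)    e Γ-true = proj₁ (soundness d e Γ-true)
soundness (∧E₂ d)    e Γ-true = proj₂ (soundness d e Γ-true)
soundness (∨I₁ d)    e Γ-true = inj₁ (soundness d e Γ-true)
soundness (∨I₂ d)    e Γ-true = inj₂ (soundness d e Γ-true)
soundness (∨E d l r) e Γ-true with soundness d e Γ-true
... | inj₁ a = soundness l e (a All.∷ Γ-true)
... | inj₂ b = soundness r e (b All.∷ Γ-true)
soundness (⇒I d)     e Γ-true = λ a → soundness d e (a All.∷ Γ-true)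
soundness (⇒E d d')  e Γ-true = soundness d e Γ-true (soundness d' e Γ-true)
soundness (∀I d)     e Γ-true = λ k → soundness d (cons k e) (map-wkF-true k Γ-true)
soundness (∀E {A} d t) e Γ-true = from ([]-sem refl A) (soundness d e Γ-true (⟦ t ⟧t e))
soundness (∃I {A} t d) e Γ-true = ⟦ t ⟧t e , to ([]-sem refl A) (soundness d e Γ-true)
soundness (∃E {A} {B} d d') e Γ-true with soundness d e Γ-true
... | k , a = to (wkF-sem B k e) (soundness d' (cons k e) (a All.∷ map-wkF-true k Γ-true))
soundness refl'      e Γ-true = refl
soundness (≐E {A = A} s≐t d) e Γ-true =
  from ([]-sem refl A) (subst (λ a → ⟦ A ⟧ (cons a e)) (soundness s≐t e Γ-true)
                              (to ([]-sem refl A) (soundness d e Γ-true)))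

close-true : ∀ {n} (A : Formula n) → (∀ e → ⟦ A ⟧ e) → ℕ⊨ close A
close-true {zero}  A A-true = A-true noEnv
close-true {suc n} A A-true = close-true (∀' A) λ e k → A-true (cons k e)

indF-true : ∀ {n} (φ : Formula (suc n)) e → ⟦ indF φ ⟧ e
indF-true φ e (base , step) = go
  where
  go : ∀ k → ⟦ φ ⟧ (cons k e)
  go zero    = to ([]-sem refl φ) base
  go (suc k) = to (subF-sem (λ { fz → refl ; (fs i) → refl }) φ) (step k (go k))

IΣ1Ax-true : ∀ {A} → IΣ1Ax A → ℕ⊨ A
IΣ1Ax-true Q1        = λ k ()
IΣ1Ax-true Q2        = λ a b → suc-injective
IΣ1Ax-true Q3        = +-identityʳ
IΣ1Ax-true Q4        = λ a b → +-suc b a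
IΣ1Ax-true Q5        = *-zeroʳ
IΣ1Ax-true Q6        = λ a b → trans (*-suc b a) (+-comm b (b * a))
IΣ1Ax-true (Ind φ _) = close-true (indF φ) (indF-true φ)

iIΣ1-sound : ∀ {A} → ⊢iIΣ1 A → ℕ⊨ A
iIΣ1-sound (Γ , Γ-axioms , d) = soundness d noEnv (All.map IΣ1Ax-true Γ-axioms)

weaken : ∀ {n} {Γ Δ : List (Formula n)} {A} → Γ ⊆ Δ → Γ ⊢ A → Δ ⊢ A
weaken Γ⊆Δ (ax A∈Γ)   = ax (Γ⊆Δ A∈Γ)
weaken Γ⊆Δ (⊥E d)     = ⊥E (weaken Γ⊆Δ d)
weaken Γ⊆Δ (∧I d d')  = ∧I (weaken Γ⊆Δ d) (weaken Γ⊆Δ d')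
weaken Γ⊆Δ (∧E₁ d)    = ∧E₁ (weaken Γ⊆Δ d)
weaken Γ⊆Δ (∧E₂ d)    = ∧E₂ (weaken Γ⊆Δ d)
weaken Γ⊆Δ (∨I₁ d)    = ∨I₁ (weaken Γ⊆Δ d)
weaken Γ⊆Δ (∨I₂ d)    = ∨I₂ (weaken Γ⊆Δ d)
weaken Γ⊆Δ (∨E d l r) = ∨E (weaken Γ⊆Δ d) (weaken (⊆.∷⁺ʳ _ Γ⊆Δ) l) (weaken (⊆.∷⁺ʳ _ Γ⊆Δ) r)
weaken Γ⊆Δ (⇒I d)     = ⇒I (weaken (⊆.∷⁺ʳ _ Γ⊆Δ) d)
weaken Γ⊆Δ (⇒E d d')  = ⇒E (weaken Γ⊆Δ d) (weaken Γ⊆Δ d')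
weaken Γ⊆Δ (∀I d)     = ∀I (weaken (⊆.map⁺ wkF Γ⊆Δ) d)
weaken Γ⊆Δ (∀E d t)   = ∀E (weaken Γ⊆Δ d) t
weaken Γ⊆Δ (∃I t d)   = ∃I t (weaken Γ⊆Δ d)
weaken Γ⊆Δ (∃E d d')  = ∃E (weaken Γ⊆Δ d) (weaken (⊆.∷⁺ʳ _ (⊆.map⁺ wkF Γ⊆Δ)) d')
weaken Γ⊆Δ refl'      = refl'
weaken Γ⊆Δ (≐E e d)   = ≐E (weaken Γ⊆Δ e) (weaken Γ⊆Δ d)

module _ (T : Theory) where

  ᵀ-mp : ∀ {A B} → T ⊢ (A ⇒ B) ᵀ → T ⊢ A ᵀ → T ⊢ B ᵀ
  ᵀ-mp (Γ , Γ-ax , d) (Δ , Δ-ax , d') =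
    Γ ++ Δ , Allₚ.++⁺ Γ-ax Δ-ax , ⇒E (weaken (⊆.xs⊆xs++ys Γ Δ) d) (weaken (⊆.xs⊆ys++xs Δ Γ) d')

  iIΣ1⇒ᵀ : ∀ {A} → ⊢iIΣ1 A → T ⊢ A ᵀ
  iIΣ1⇒ᵀ (Γ , Γ-ax , d) = Γ , All.map inj₁ Γ-ax , d

  closed⇒ᵀ : ∀ {A} → [] ⊢ A → T ⊢ A ᵀ
  closed⇒ᵀ d = [] , [] , d

∃I₀ : ∀ {n} {Γ : List (Formula (suc n))} {A} → Γ ⊢ A → Γ ⊢ wkF (∃' A)
∃I₀ {Γ = Γ} {A} d = ∃I (var fz) (subst (Γ ⊢_) (sym ([var₀]-wk₁ A)) d)

∀E₀ : ∀ {n} {Γ : List (Formula (suc n))} {A} → Γ ⊢ wkF (∀' A) → Γ ⊢ A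
∀E₀ {Γ = Γ} {A} d = subst (Γ ⊢_) ([var₀]-wk₁ A) (∀E d (var fz))

-- φ ∧ ψ with ψ moved under the ∃-prefix of φ, so that it is Σ1 when ψ is Δ0.
pushConj : ∀ {n} (φ : Formula n) → IsΣ1 φ → Formula n → Formula n
pushConj φ      (σΔ0 _) ψ = φ ∧' ψ
pushConj (∃' φ) (σ∃ s)  ψ = ∃' (pushConj φ s (wkF ψ))

pushConj-Σ1 : ∀ {n} {φ : Formula n} (s : IsΣ1 φ) {ψ : Formula n} → IsΔ0 ψ → IsΣ1 (pushConj φ s ψ)
pushConj-Σ1 (σΔ0 a) b = σΔ0 (δ∧ a b)
pushConj-Σ1 (σ∃ s)  b = σ∃ (pushConj-Σ1 s (wkΔ0 b))

pushConj-sound : ∀ {n} {φ : Formula n} (s : IsΣ1 φ) {ψ : Formula n} {e : Fin n → ℕ} →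
                 ⟦ pushConj φ s ψ ⟧ e → ⟦ φ ⟧ e × ⟦ ψ ⟧ e
pushConj-sound (σΔ0 _) φψ = φψ
pushConj-sound (σ∃ s) {ψ} {e} (k , φψ) with pushConj-sound s φψ
... | φ-true , ψ-true = (k , φ-true) , to (wkF-sem ψ k e) ψ-true

pushConj-intro : ∀ {n} {φ : Formula n} (s : IsΣ1 φ) {ψ : Formula n} {Γ : List (Formula n)} →
                 (φ ∧' ψ) ∈ Γ → Γ ⊢ pushConj φ s ψ
pushConj-intro (σΔ0 _) φψ∈Γ = ax φψ∈Γ
pushConj-intro (σ∃ s)  φψ∈Γ =
  ∃E (∧E₁ (ax φψ∈Γ))
     (∃I₀ (⇒E (⇒I (pushConj-intro s (here refl)))
              (∧I (ax (here refl)) (∧E₂ (ax (there (∈-map⁺ wkF φψ∈Γ)))))))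

-- Reading R and D with x as variable 1 and y as variable 0, ImageOutside R s D is
-- ∃x ∃y (R(x,y) ∧ ¬D(x,y)) and ∃' (¬' (∃' (R ∧' D))) is ∃x ¬∃y (R(x,y) ∧ D(x,y)).  With R = hx=y,
-- the codes code⊑ m and code≼ n are those of the latter for D = (y ⊑ m) and D = (y ≼ n).
ImageOutside : (R : Formula 2) → IsΣ1 R → Formula 2 → Sentence
ImageOutside R s D = ∃' (∃' (pushConj R s (¬' D)))

module _ {R : Formula 2} (s : IsΣ1 R) (D : Formula 2) where

  noImageIn⇒imageOutside : (∃' (¬' (∃' (R ∧' D))) ∷ ∀' (∃' R) ∷ []) ⊢ ImageOutside R s D
  noImageIn⇒imageOutside =
    ∃E (ax (here refl)) (∃I₀ (∃E (∀E₀ (ax (there (there (here refl))))) (∃I₀ image-outside)))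
    where
    not-in : _ ∷ _ ∷ _ ⊢ ¬' D
    not-in = ⇒I (⇒E (ax (there (there (here refl))))
                    (∃I₀ (∧I (ax (there (here refl))) (ax (here refl)))))
    image-outside : _ ⊢ pushConj R s (¬' D)
    image-outside = ⇒E (⇒I (pushConj-intro s (here refl))) (∧I (ax (here refl)) not-in)

  imageOutside-Σ1 : IsΔ0 D → IsΣ1 (ImageOutside R s D)
  imageOutside-Σ1 δ = σ∃ (σ∃ (pushConj-Σ1 s (δ⇒ δ δ⊥)))

  imageOutside-sound : ℕ⊨ ImageOutside R s D →
                       Σ ℕ λ x → Σ ℕ λ y → ⟦ R ⟧ (env₂ y x) × ¬ ⟦ D ⟧ (env₂ y x)
  imageOutside-sound (x , y , image-outside) = x , y , pushConj-sound s image-outside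

  noImageIn⇒imageOutsideᵀ : ∀ T → ⊢iIΣ1 (∀' (∃' R)) → T ⊢ (∃' (¬' (∃' (R ∧' D))) ⇒ ImageOutside R s D) ᵀ
  noImageIn⇒imageOutsideᵀ T total =
    ᵀ-mp T (closed⇒ᵀ T (⇒I (⇒I noImageIn⇒imageOutside))) (iIΣ1⇒ᵀ T total)

proof⇒at : ∀ (Prf : Formula 2) {k} A → ℕ⊨ (Prf ⟨ num k ∣ num ⌜ A ⌝ ⟩) → ℕ⊨ at (∃' Prf) A
proof⇒at Prf {k} A prf =
  from ([]-sem (num-sem ⌜ A ⌝ noEnv) (∃' Prf)) (k , to (num⟨∣⟩-sem Prf k ⌜ A ⌝) prf)

module _ {T : Theory} {P : Formula 1} (P-prov : IsProvabilityPredicate T P) where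
  open IsProvabilityPredicate P-prov

  at-Σ1 : ∀ A → IsΣ1 (at P A)
  at-Σ1 A = subΣ1 (sub1 (num ⌜ A ⌝)) isΣ1

  Σ1-true⇒at-true : ∀ {S} → IsΣ1 S → ℕ⊨ S → ℕ⊨ at P S
  Σ1-true⇒at-true {S} s = iIΣ1-sound (Σ1Com S s)

  at-true-mp : ∀ {A B} → T ⊢ (A ⇒ B) ᵀ → ℕ⊨ at P A → ℕ⊨ at P B
  at-true-mp {A} {B} d = iIΣ1-sound (D2 A B) (D1 (A ⇒ B) d)

module GoodPairReflection {T : Theory} {Prf□ Prf△ : Formula 2} (good : GoodPair T Prf□ Prf△) where
  open GoodPair good

  □_ △_ : Sentence → Sentence
  □ A = at (∃' Prf□) A
  △ A = at (∃' Prf△) A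

  Σ1-complete : ∀ {S} → IsΣ1 S → ℕ⊨ S → T ⊢ S ᵀ
  Σ1-complete {S} s = □-sound S ∘ Σ1-true⇒at-true P-prov s

  module _ (Σ1-sound : Σ1-Sound T) where

    □-reflection : ∀ {S} → IsΣ1 S → ℕ⊨ □ S → ℕ⊨ S
    □-reflection {S} s = Σ1-sound S s ∘ □-sound S

    △-reflection : ∀ {S} → IsΣ1 S → ℕ⊨ △ S → ℕ⊨ S
    △-reflection {S} s △S = □-reflection s (Σ1-sound (□ S) (at-Σ1 P-prov S) ⊢□S)
      where
      ⊢□△S : T ⊢ □ △ S ᵀ
      ⊢□△S = Σ1-complete (at-Σ1 P-prov (△ S)) (Σ1-true⇒at-true P-prov (at-Σ1 Q-prov S) △S)
      ⊢□S : T ⊢ □ S ᵀ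
      ⊢□S = ᵀ-mp T (□△ S s) ⊢□△S

-- The orders ≼ and ⊏ on ℕ

module OrderProperties (M : FiniteIRModel) where
  open FiniteIRModel M
    renaming (≼-refl to ≼₀-refl; ≼-trans to ≼₀-trans; ≼-antisym to ≼₀-antisym; ≼⊏ to ≼₀-⊏₀-trans)
  open Ordering M

  ≼-refl : ∀ {w} → w ≼ w
  ≼-refl {zero}  = inj₂ (inj₂ refl)
  ≼-refl {suc w} with suc w ≤? r
  ... | yes w≤r = inj₁ ((s≤s z≤n , w≤r) , (s≤s z≤n , w≤r) , ≼₀-refl (s≤s z≤n , w≤r))
  ... | no  w≰r = inj₂ (inj₁ (≰⇒> w≰r , s≤s z≤n , ≤-refl))

  ≼-trans : ∀ {i j k} → i ≼ j → j ≼ k → i ≼ k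
  ≼-trans (inj₂ (inj₂ i≡0)) _ = inj₂ (inj₂ i≡0)
  ≼-trans (inj₁ (i∈W , j∈W , i≼j)) (inj₁ (_ , k∈W , j≼k)) =
    inj₁ (i∈W , k∈W , ≼₀-trans i∈W j∈W k∈W i≼j j≼k)
  ≼-trans (inj₁ (_ , (_ , j≤r) , _)) (inj₂ (inj₁ (r<j , _))) = ⊥-elim (≤⇒≯ j≤r r<j)
  ≼-trans (inj₁ (_ , (() , _) , _)) (inj₂ (inj₂ refl))
  ≼-trans (inj₂ (inj₁ (r<i , _))) (inj₁ (_ , (1≤k , k≤r) , _)) =
    inj₂ (inj₁ (r<i , 1≤k , ≤-trans k≤r (<⇒≤ r<i)))
  ≼-trans (inj₂ (inj₁ (r<i , _ , j≤i))) (inj₂ (inj₁ (_ , 1≤k , k≤j))) =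
    inj₂ (inj₁ (r<i , 1≤k , ≤-trans k≤j j≤i))
  ≼-trans (inj₂ (inj₁ (_ , () , _))) (inj₂ (inj₂ refl))

  ⊏⇒≼ : ∀ {i j} → i ⊏ j → i ≼ j
  ⊏⇒≼ (inj₁ (i∈W , j∈W , i⊏j))       = inj₁ (i∈W , j∈W , realistic i∈W j∈W i⊏j)
  ⊏⇒≼ (inj₂ (inj₁ (r<i , 1≤j , j<i))) = inj₂ (inj₁ (r<i , 1≤j , <⇒≤ j<i))
  ⊏⇒≼ (inj₂ (inj₂ (i≡0 , _)))         = inj₂ (inj₂ i≡0)

  ⊏-positive : ∀ {i j} → i ⊏ j → 1 ≤ j
  ⊏-positive (inj₁ (_ , (1≤j , _) , _))  = 1≤j
  ⊏-positive (inj₂ (inj₁ (_ , 1≤j , _))) = 1≤j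
  ⊏-positive (inj₂ (inj₂ (_ , 0<j)))     = 0<j

  ≼-⊏-trans : ∀ {i j k} → i ≼ j → j ⊏ k → i ⊏ k
  ≼-⊏-trans (inj₂ (inj₂ i≡0)) j⊏k = inj₂ (inj₂ (i≡0 , ⊏-positive j⊏k))
  ≼-⊏-trans (inj₁ (i∈W , j∈W , i≼j)) (inj₁ (_ , k∈W , j⊏k)) =
    inj₁ (i∈W , k∈W , ≼₀-⊏₀-trans i∈W j∈W k∈W i≼j j⊏k)
  ≼-⊏-trans (inj₁ (_ , (_ , j≤r) , _)) (inj₂ (inj₁ (r<j , _))) = ⊥-elim (≤⇒≯ j≤r r<j)
  ≼-⊏-trans (inj₁ (_ , (() , _) , _)) (inj₂ (inj₂ (refl , _)))
  ≼-⊏-trans (inj₂ (inj₁ (r<i , _))) (inj₁ (_ , (1≤k , k≤r) , _)) =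
    inj₂ (inj₁ (r<i , 1≤k , ≤-<-trans k≤r r<i))
  ≼-⊏-trans (inj₂ (inj₁ (r<i , _ , j≤i))) (inj₂ (inj₁ (_ , 1≤k , k<j))) =
    inj₂ (inj₁ (r<i , 1≤k , <-≤-trans k<j j≤i))
  ≼-⊏-trans (inj₂ (inj₁ (_ , () , _))) (inj₂ (inj₂ (refl , _)))

  world : Fin r → ℕ
  world i = suc (toℕ i)

  world∈W : ∀ i → InW r (world i)
  world∈W i = s≤s z≤n , toℕ<n i

  ∈W⇒world : ∀ {w} → InW r w → Σ (Fin r) λ i → world i ≡ w
  ∈W⇒world {suc w} (_ , w<r) = fromℕ< w<r , cong suc (toℕ-fromℕ< w<r)

  _≼ᶠ_ : Rel (Fin r) 0ℓ
  i ≼ᶠ j = world i ≼₀ world j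

  ≼ᶠ-isPartialOrder : IsPartialOrder _≡_ _≼ᶠ_
  ≼ᶠ-isPartialOrder = record
    { isPreorder = record
      { isEquivalence = isEquivalence
      ; reflexive     = λ { {i} refl → ≼₀-refl (world∈W i) }
      ; trans         = λ {i} {j} {k} → ≼₀-trans (world∈W i) (world∈W j) (world∈W k)
      }
    ; antisym = λ {i} {j} i≼j j≼i →
        toℕ-injective (suc-injective (≼₀-antisym (world∈W i) (world∈W j) i≼j j≼i))
    }

  _≺ᶠ_ : Rel (Fin r) 0ℓ
  _≺ᶠ_ = NonStrictToStrict._<_ _≡_ _≼ᶠ_

  acc-world : ∀ {i} → Acc (flip _≺ᶠ_) i → Acc (flip _≺_) (world i)
  acc-world {i} (acc rs) = acc λ where
    (inj₁ (_ , w∈W , i≼w) , i≢w) → case ∈W⇒world w∈W of λ where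
       (j , refl) → acc-world (rs (i≼w , λ { refl → i≢w refl }))
    (inj₂ (inj₁ (r<i , _)) , _) → ⊥-elim (≤⇒≯ (toℕ<n i) r<i)
    (inj₂ (inj₂ ()) , _)

  acc-positive : ∀ {w} → Acc _<_ w → 1 ≤ w → Acc (flip _≺_) w
  acc-positive {w} (acc rs) 1≤w with w ≤? r
  ... | yes w≤r = case ∈W⇒world (1≤w , w≤r) of λ where
        (i , refl) → acc-world (po-noetherian ≼ᶠ-isPartialOrder i)
  ... | no  w≰r = acc λ where
        (inj₁ ((_ , w≤r) , _) , _)          → ⊥-elim (w≰r w≤r)
        (inj₂ (inj₁ (_ , 1≤u , u≤w)) , w≢u) → acc-positive (rs (≤∧≢⇒< u≤w (w≢u ∘ sym))) 1≤u
        (inj₂ (inj₂ refl) , _)              → ⊥-elim (<⇒≱ 1≤w z≤n)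

  ≺-noetherian : WellFounded (flip _≺_)
  ≺-noetherian zero    = acc λ (_ , 0≢u) → acc-positive (<-wellFounded _) (n≢0⇒n>0 (0≢u ∘ sym))
  ≺-noetherian (suc w) = acc-positive (<-wellFounded _) (s≤s z≤n)

module _ {a ℓ} {A : Set a} {_∼_ : Rel A ℓ} (∼-refl : Reflexive _∼_) (∼-trans : Transitive _∼_)
         {f : ℕ → A} (step : ∀ k → f k ∼ f (suc k)) where

  stepwise⇒monotone : ∀ {x y} → x ≤′ y → f x ∼ f y
  stepwise⇒monotone ≤′-refl        = ∼-refl
  stepwise⇒monotone (≤′-step x≤′y) = ∼-trans (stepwise⇒monotone x≤′y) (step _)

module _ {a} {A : Set a} (_≟ᴬ_ : DecidableEquality A) (f : ℕ → A) where

  first-change : ∀ {i x} → i ≤′ x → f x ≢ f i → Σ ℕ λ j → f j ≡ f i × f (suc j) ≢ f i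
  first-change ≤′-refl fx≢fi = ⊥-elim (fx≢fi refl)
  first-change {i} {suc x} (≤′-step i≤′x) fsx≢fi with f x ≟ᴬ f i
  ... | yes fx≡fi = x , fx≡fi , fsx≢fi
  ... | no  fx≢fi = first-change i≤′x fx≢fi

  module _ {ℓ} {_⊰_ : Rel A ℓ} (⊰-noetherian : WellFounded (flip _⊰_))
           (change⇒⊰ : ∀ k → f k ≢ f (suc k) → f k ⊰ f (suc k))
           (no-last-change : ∀ j → f j ≢ f (suc j) → ¬ (∀ x → suc j ≤ x → f x ≡ f (suc j))) where

    ChangesAfter : ℕ → Set a
    ChangesAfter j = Σ ℕ λ x → suc j ≤ x × f x ≢ f (suc j)

    change-impossible : ∀ j → Acc (flip _⊰_) (f (suc j)) → f j ≢ f (suc j) → ⊥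
    change-impossible j (acc rs) fj≢fsj = ¬¬-excluded-middle {A = ChangesAfter j} λ where
      (yes (x , sj≤x , fx≢fsj)) →
        let j′ , fj′≡fsj , fsj′≢fsj = first-change (≤⇒≤′ sj≤x) fx≢fsj
            fj′≢fsj′ = λ e → fsj′≢fsj (trans (sym e) fj′≡fsj)
        in change-impossible j′ (rs (subst (_⊰ f (suc j′)) fj′≡fsj (change⇒⊰ j′ fj′≢fsj′))) fj′≢fsj′
      (no no-later-change) → no-last-change j fj≢fsj λ x sj≤x →
        decidable-stable (f x ≟ᴬ f (suc j)) λ fx≢fsj → no-later-change (x , sj≤x , fx≢fsj)

    no-last-change⇒constant : ∀ n → f n ≡ f 0
    no-last-change⇒constant n = decidable-stable (f n ≟ᴬ f 0) λ fn≢f0 →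
      let j , fj≡f0 , fsj≢f0 = first-change (≤⇒≤′ z≤n) fn≢f0
      in change-impossible j (⊰-noetherian _) λ e → fsj≢f0 (trans (sym e) fj≡f0)

module NoLastChange {T : Theory} {Prf□ Prf△ : Formula 2} (good : GoodPair T Prf□ Prf△)
  (Σ1-sound : Σ1-Sound T) {M : FiniteIRModel} (F : Ordering.Formalization M)
  {H : Formula 2} {h : ℕ → ℕ} (H-Σ1 : IsΣ1 H) (total : Ordering.Codes.Total M F H)
  (graph : Ordering.Codes.Graph M F H h) (steps : Ordering.Codes.Steps M F H Prf□ Prf△ h) where
  open Ordering M
  open Formalization F
  open Codes F H
  open OrderProperties M
  open GoodPair good
  open GoodPairReflection good

  -- Case analysis goes through helpers rather than `with steps k`, whose abstraction would
  -- normalise a type containing Gödel codes.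
  step≼ : ∀ k → h k ≼ h (suc k)
  step≼ k = moves (steps k)
    where
    moves : Step Prf□ Prf△ h k → h k ≼ h (suc k)
    moves (inj₁ (_ , (hk⊏m , _) , hsk≡m))                  = subst (h k ≼_) (sym hsk≡m) (⊏⇒≼ hk⊏m)
    moves (inj₂ (inj₁ (_ , _ , ((hk≼n , _) , _) , hsk≡n))) = subst (h k ≼_) (sym hsk≡n) hk≼n
    moves (inj₂ (inj₂ (_ , _ , hsk≡hk)))                   = subst (h k ≼_) (sym hsk≡hk) ≼-refl

  monotone : ∀ {x y} → x ≤ y → h x ≼ h y
  monotone = stepwise⇒monotone {_∼_ = _≼_} ≼-refl ≼-trans step≼ ∘ ≤⇒≤′

  hx=y-Σ1 : IsΣ1 hx=y
  hx=y-Σ1 = subΣ1 _ H-Σ1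

  hx=y-sound : ∀ {x y} → ⟦ hx=y ⟧ (env₂ y x) → h x ≡ y
  hx=y-sound {x} {y} = proj₁ (graph x y) ∘ from (num⟨∣⟩-sem H x y) ∘ to (⟨∣⟩-sem refl refl H)

  image-never-outside : ∀ {D} → (∀ x → ⟦ D ⟧ (env₂ (h x) x)) → ¬ ℕ⊨ ImageOutside hx=y hx=y-Σ1 D
  image-never-outside {D} D-holds outside with imageOutside-sound hx=y-Σ1 D outside
  ... | x , y , hx=y-true , ¬D = ¬D (subst (λ z → ⟦ D ⟧ (env₂ z x)) (hx=y-sound hx=y-true) (D-holds x))

  -- D is typed Formula (suc (suc 0)) rather than Formula 2 so that, given at the call sites, it
  -- elaborates exactly as inside code⊑ and code≼; Agda then identifies the Gödel codes
  -- syntactically instead of evaluating them.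
  module _ (D : Formula (suc (suc 0))) (δ : IsΔ0 D) (D-holds : ∀ x → ⟦ D ⟧ (env₂ (h x) x)) where

    ⊢noImageIn⇒imageOutside : T ⊢ (∃' (¬' (∃' (hx=y ∧' D))) ⇒ ImageOutside hx=y hx=y-Σ1 D) ᵀ
    ⊢noImageIn⇒imageOutside = noImageIn⇒imageOutsideᵀ hx=y-Σ1 D T total

    no-Prf□-proof : ∀ {k} → ¬ ℕ⊨ (Prf□ ⟨ num k ∣ num ⌜ ∃' (¬' (∃' (hx=y ∧' D))) ⌝ ⟩)
    no-Prf□-proof = image-never-outside D-holds
              ∘ □-reflection Σ1-sound (imageOutside-Σ1 hx=y-Σ1 D δ)
              ∘ at-true-mp P-prov ⊢noImageIn⇒imageOutside
              ∘ proof⇒at Prf□ (∃' (¬' (∃' (hx=y ∧' D))))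

    no-Prf△-proof : ∀ {k} → ¬ ℕ⊨ (Prf△ ⟨ num k ∣ num ⌜ ∃' (¬' (∃' (hx=y ∧' D))) ⌝ ⟩)
    no-Prf△-proof = image-never-outside D-holds
              ∘ △-reflection Σ1-sound (imageOutside-Σ1 hx=y-Σ1 D δ)
              ∘ at-true-mp Q-prov ⊢noImageIn⇒imageOutside
              ∘ proof⇒at Prf△ (∃' (¬' (∃' (hx=y ∧' D))))

  box-move-not-last : ∀ {j m} → BoxMove Prf□ h j m → ¬ (∀ x → suc j ≤ x → h x ≡ m)
  box-move-not-last {j} {m} (hj⊏m , proof) stays =
    no-Prf□-proof (Sq ⟨ var fz ∣ num m ⟩ ∨' var fz ≐ num m) (δ∨ (subΔ0 _ Sq-Δ0) δ≐)
                  (λ x → ⊑m (≤-<-connex x j)) proof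
    where
    ⊑m : ∀ {x} → x ≤ j ⊎ j < x → ⟦ Sq ⟨ var fz ∣ num m ⟩ ∨' var fz ≐ num m ⟧ (env₂ (h x) x)
    ⊑m (inj₁ x≤j) = inj₁ (⟨var₀∣num⟩-intro Sq (proj₂ (Sq-ok _ m) (≼-⊏-trans (monotone x≤j) hj⊏m)))
    ⊑m {x} (inj₂ j<x) = inj₂ (trans (stays x j<x) (sym (num-sem m _)))

  tri-move-not-last : ∀ {j n} → TriMove Prf△ h j n → ¬ (∀ x → suc j ≤ x → h x ≡ n)
  tri-move-not-last {j} {n} ((hj≼n , _) , proof) stays =
    no-Prf△-proof (Le ⟨ var fz ∣ num n ⟩) (subΔ0 _ Le-Δ0)
                  (λ x → ≼n (≤-<-connex x j)) proof
    where
    ≼n : ∀ {x} → x ≤ j ⊎ j < x → ⟦ Le ⟨ var fz ∣ num n ⟩ ⟧ (env₂ (h x) x)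
    ≼n (inj₁ x≤j) = ⟨var₀∣num⟩-intro Le (proj₂ (Le-ok _ n) (≼-trans (monotone x≤j) hj≼n))
    ≼n {x} (inj₂ j<x) = ⟨var₀∣num⟩-intro Le (proj₂ (Le-ok _ n) (subst (_≼ n) (sym (stays x j<x)) ≼-refl))

  no-last-change : ∀ j → h j ≢ h (suc j) → ¬ (∀ x → suc j ≤ x → h x ≡ h (suc j))
  no-last-change j change stays = moves (steps j)
    where
    moves : Step Prf□ Prf△ h j → ⊥
    moves (inj₁ (_ , box , hsj≡m)) =
      box-move-not-last box λ x sj≤x → trans (stays x sj≤x) hsj≡m
    moves (inj₂ (inj₁ (_ , _ , tri , hsj≡n))) =
      tri-move-not-last tri λ x sj≤x → trans (stays x sj≤x) hsj≡n
    moves (inj₂ (inj₂ (_ , _ , hsj≡hj))) = change (sym hsj≡hj)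

proposition3p13 : (T : Theory) (Prf□ Prf△ : Formula 2) → GoodPair T Prf□ Prf△ →
    (M : FiniteIRModel) (F : Ordering.Formalization M) (H : Formula 2) (h : ℕ → ℕ) →
    Ordering.Codes.DefinesH M F H Prf□ Prf△ h →
    Σ1-Sound T →
    ∀ (n : ℕ) → h n ≡ 0
proposition3p13 T Prf□ Prf△ good M F H h (H-Σ1 , total , graph , h0 , steps) Σ1-sound n =
  trans (no-last-change⇒constant _≟_ h ≺-noetherian (λ k → step≼ k ,_) no-last-change n) h0
  where
  open OrderProperties M
  open NoLastChange good Σ1-sound F H-Σ1 total graph steps
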